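{- Let $k$ be a field of characteristic $2$ and $n,m\ge1$. In the ring $R=k[X]/(Q_n)\otimes_k k[Y]/(Q_m)$, every doubly symmetric configuration is divisible by the central configuration $c$. Moreover, if $n$ and $m$ are both odd, then $c$ is divisible by the all-on configuration $\sum_{i=0}^{n-1}\sum_{j=0}^{m-1}Q_i(x_n)Q_j(y_m)$.
   Context: The polynomials $Q_n$ are defined by $Q_0=1$, $Q_1=X$, $Q_{n+1}=XQ_n+Q_{n-1}$. Let $x_n$, $y_m$ be the classes of $X$, $Y$ in $R$. The space of configurations $k^n\otimes k^m$ on the $n\times m$ grid is identified with $R$ via the $k$-linear isomorphism $k[X]/(Q_n)\to k^n$, $X^i\mapsto J_n^ie_1$ (and similarly for $m$), where $J_n$ is the $n\times n$ matrix with $1$'s directly above and below the diagonal and $0$'s elsewhere; under it, the configuration with only vertex $(i,j)$ lit ($1\le i\le n$, $1\le j\le m$) corresponds to $Q_{i-1}(x_n)Q_{j-1}(y_m)$. A configuration $\sum_{i,j}y_{i,j}Q_{i-1}(x_n)Q_{j-1}(y_m)$ is doubly symmetric if $y_{i,j}=y_{n+1-i,j}=y_{i,m+1-j}=y_{n+1-i,m+1-j}$ for all $i,j$. The central configuration is $c=c_nd_m$ where $c_n=Q_{(n-1)/2}(x_n)$ if $n$ is odd and $c_n=Q_{n/2}(x_n)+Q_{n/2-1}(x_n)$ if $n$ is even, and $d_m$ is defined in the same way with $m$ and $y_m$. -}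

module Defs where

open import Level using (Level; _⊔_)
open import Algebra.Bundles using (CommutativeRing)
open import Data.Nat.Base using (ℕ; zero; suc; ⌊_/2⌋; pred; _%_; _≡ᵇ_)
open import Data.Bool.Base using (if_then_else_)
open import Data.Fin.Base using (Fin; toℕ; opposite)
open import Data.List.Base using (List; []; _∷_; map; foldr; allFin)
open import Data.Product using (Σ; ∃; _×_)
open import Relation.Nullary using (¬_)

IsField : ∀ {c ℓ} → CommutativeRing c ℓ → Set (c ⊔ ℓ)
IsField K = ¬ (1# ≈ 0#) × (∀ x → ¬ (x ≈ 0#) → ∃ λ y → x * y ≈ 1#)
  where open CommutativeRing K

Char2 : ∀ {c ℓ} → CommutativeRing c ℓ → Set ℓ
Char2 K = 1# + 1# ≈ 0#
  where open CommutativeRing K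

module Poly {c ℓ} (K : CommutativeRing c ℓ) where
  open CommutativeRing K

  -- Univariate polynomials over K: coefficient lists, lowest degree first.
  Poly₁ : Set c
  Poly₁ = List Carrier

  _⊕_ : Poly₁ → Poly₁ → Poly₁
  [] ⊕ q = q
  (a ∷ p) ⊕ [] = a ∷ p
  (a ∷ p) ⊕ (b ∷ q) = (a + b) ∷ (p ⊕ q)

  scale : Carrier → Poly₁ → Poly₁
  scale a = map (a *_)

  _⊗_ : Poly₁ → Poly₁ → Poly₁
  [] ⊗ q = []
  (a ∷ p) ⊗ q = scale a q ⊕ (0# ∷ (p ⊗ q))

  X : Poly₁
  X = 0# ∷ 1# ∷ []

  Q : ℕ → Poly₁
  Q zero = 1# ∷ []
  Q (suc zero) = X
  Q (suc (suc n)) = (X ⊗ Q (suc n)) ⊕ Q n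

  coeff : Poly₁ → ℕ → Carrier
  coeff [] _ = 0#
  coeff (a ∷ p) zero = a
  coeff (a ∷ p) (suc i) = coeff p i

  -- Bivariate polynomials in k[X,Y]: Σ_j P_j(X) Y^j, as a list of the
  -- X-polynomials P_j, lowest Y-degree first.
  Poly₂ : Set c
  Poly₂ = List Poly₁

  _⊕₂_ : Poly₂ → Poly₂ → Poly₂
  [] ⊕₂ q = q
  (a ∷ p) ⊕₂ [] = a ∷ p
  (a ∷ p) ⊕₂ (b ∷ q) = (a ⊕ b) ∷ (p ⊕₂ q)

  _⊗₂_ : Poly₂ → Poly₂ → Poly₂
  [] ⊗₂ q = []
  (a ∷ p) ⊗₂ q = map (a ⊗_) q ⊕₂ ([] ∷ (p ⊗₂ q))

  neg₂ : Poly₂ → Poly₂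
  neg₂ = map (map (λ a → - a))

  scale₂ : Carrier → Poly₂ → Poly₂
  scale₂ a = map (scale a)

  inX : Poly₁ → Poly₂
  inX p = p ∷ []

  inY : Poly₁ → Poly₂
  inY = map (λ a → a ∷ [])

  coeffY : Poly₂ → ℕ → Poly₁
  coeffY [] _ = []
  coeffY (a ∷ p) zero = a
  coeffY (a ∷ p) (suc j) = coeffY p j

  coeff₂ : Poly₂ → ℕ → ℕ → Carrier
  coeff₂ p i j = coeff (coeffY p j) i

  _≈₂_ : Poly₂ → Poly₂ → Set ℓ
  p ≈₂ q = ∀ i j → coeff₂ p i j ≈ coeff₂ q i j

  -- The ring R = k[X]/(Q_n) ⊗_k k[Y]/(Q_m) ≅ k[X,Y]/(Q_n(X), Q_m(Y)).
  -- Equality in R: the difference lies in the ideal (Q_n(X), Q_m(Y)).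
  _≡R[_,_]_ : Poly₂ → ℕ → ℕ → Poly₂ → Set (c ⊔ ℓ)
  a ≡R[ n , m ] b = ∃ λ A → ∃ λ B →
    (a ⊕₂ neg₂ b) ≈₂ ((A ⊗₂ inX (Q n)) ⊕₂ (B ⊗₂ inY (Q m)))

  _∣R[_,_]_ : Poly₂ → ℕ → ℕ → Poly₂ → Set (c ⊔ ℓ)
  d ∣R[ n , m ] a = ∃ λ r → a ≡R[ n , m ] (r ⊗₂ d)

  -- Configurations on the n×m grid; vertex (i+1, j+1) (0-based Fin
  -- indices i, j) corresponds to Q_i(x_n) Q_j(y_m).
  Config : ℕ → ℕ → Set c
  Config n m = Fin n → Fin m → Carrier

  sum₂ : List Poly₂ → Poly₂
  sum₂ = foldr _⊕₂_ []

  toR : ∀ {n m} → Config n m → Poly₂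
  toR {n} {m} y = sum₂ (map (λ i → sum₂ (map (λ j →
      scale₂ (y i j) (inX (Q (toℕ i)) ⊗₂ inY (Q (toℕ j)))) (allFin m))) (allFin n))

  DoublySymmetric : ∀ {n m} → Config n m → Set ℓ
  DoublySymmetric y = ∀ i j →
    (y i j ≈ y (opposite i) j) × (y i j ≈ y i (opposite j))
      × (y i j ≈ y (opposite i) (opposite j))

  centralFactor : ℕ → Poly₁
  centralFactor n =
    if (n % 2) ≡ᵇ 1 then Q ⌊ n /2⌋ else (Q ⌊ n /2⌋ ⊕ Q (pred ⌊ n /2⌋))

  central : ℕ → ℕ → Poly₂
  central n m = inX (centralFactor n) ⊗₂ inY (centralFactor m)

  allOn : ∀ n m → Poly₂
  allOn n m = toR {n} {m} (λ _ _ → 1#)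

-- The Q_n obey the addition formula Q_{a+b} = Q_a Q_b + Q_{a-1} Q_{b-1}, and in characteristic 2,
-- where signs are irrelevant, it can also be used to subtract indices.  It shows that
-- Q_a + Q_b is a multiple of the central factor c_n whenever a < b and a + b + 1 = n, while
-- Q_a = c_n when a = b.  A doubly symmetric configuration is a combination of Q_i(x) Q_j(y)
-- with coefficients invariant under i ↦ n-1-i and j ↦ m-1-j.  Writing each Q_i as a multiple
-- of c_n plus E_i + E_{n-1-i}, where E is Q restricted to the upper half of the indices, the
-- E-terms cancel in pairs; doing the same in y gives divisibility by c_n(x) c_m(y), already
-- in k[X, Y].
-- For n = 2k + 1 the row sum is Σ_{i<n} Q_i = Q_k v with v = Q_k + Q_{k-1}, and Cassini's
-- identity together with Q_{2k+1} = x Q_k² gives Q_k v² ≡ Q_k modulo Q_n.  Hence v(x) v(y)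
-- times the all-on configuration is the central configuration in R.
module Submission where

open import Defs
open import Level using (Level)
open import Algebra.Bundles using (CommutativeRing; AbelianGroup)
open import Data.Nat.Base using (ℕ; zero; suc; _≤_; _%_)
open import Data.List.Base using ([]; _∷_; map)
open import Data.Product using (_×_; _,_)
open import Relation.Binary.PropositionalEquality using (_≡_)
open import Function.Base using (_∘_)
import Algebra.Properties.CommutativeSemigroup as CommutativeSemigroupProperties
import Algebra.Properties.Ring as RingProperties

module PolynomialRing {c ℓ} (K : CommutativeRing c ℓ) where
  open CommutativeRing K hiding (zero)
  open RingProperties ring using (-0#≈0#)
  open Poly K

  -- A record rather than a function type, so that p and q can be inferred from p ≋ q.
  infix 4 _≋_
  record _≋_ (p q : Poly₁) : Set ℓ where
    constructor mk≋
    field coeff-≈ : ∀ i → coeff p i ≈ coeff q i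
  open _≋_ public

  neg : Poly₁ → Poly₁
  neg = map (-_)

  one : Poly₁
  one = 1# ∷ []

  coeff-⊕ : ∀ p q i → coeff (p ⊕ q) i ≈ coeff p i + coeff q i
  coeff-⊕ []      q       i       = sym (+-identityˡ _)
  coeff-⊕ (a ∷ p) []      i       = sym (+-identityʳ _)
  coeff-⊕ (a ∷ p) (b ∷ q) zero    = refl
  coeff-⊕ (a ∷ p) (b ∷ q) (suc i) = coeff-⊕ p q i

  coeff-scale : ∀ a p i → coeff (scale a p) i ≈ a * coeff p i
  coeff-scale a []      i       = sym (zeroʳ a)
  coeff-scale a (b ∷ p) zero    = refl
  coeff-scale a (b ∷ p) (suc i) = coeff-scale a p i

  coeff-neg : ∀ p i → coeff (neg p) i ≈ - coeff p i
  coeff-neg []      i       = sym -0#≈0#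
  coeff-neg (b ∷ p) zero    = refl
  coeff-neg (b ∷ p) (suc i) = coeff-neg p i

  ≋-refl : ∀ {p} → p ≋ p
  ≋-refl = mk≋ λ _ → refl

  ≋-sym : ∀ {p q} → p ≋ q → q ≋ p
  ≋-sym e = mk≋ λ i → sym (coeff-≈ e i)

  ≋-trans : ∀ {p q r} → p ≋ q → q ≋ r → p ≋ r
  ≋-trans e f = mk≋ λ i → trans (coeff-≈ e i) (coeff-≈ f i)

  ∷-cong : ∀ {a b p q} → a ≈ b → p ≋ q → (a ∷ p) ≋ (b ∷ q)
  ∷-cong e f = mk≋ λ where
    zero    → e
    (suc i) → coeff-≈ f i

  0∷[]≋[] : (0# ∷ []) ≋ []
  0∷[]≋[] = mk≋ λ where
    zero    → refl
    (suc i) → refl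

  ⊕-cong : ∀ {p p′ q q′} → p ≋ p′ → q ≋ q′ → (p ⊕ q) ≋ (p′ ⊕ q′)
  ⊕-cong {p} {p′} {q} {q′} e f = mk≋ λ i →
    trans (coeff-⊕ p q i) (trans (+-cong (coeff-≈ e i) (coeff-≈ f i)) (sym (coeff-⊕ p′ q′ i)))

  neg-cong : ∀ {p q} → p ≋ q → neg p ≋ neg q
  neg-cong {p} {q} e = mk≋ λ i →
    trans (coeff-neg p i) (trans (-‿cong (coeff-≈ e i)) (sym (coeff-neg q i)))

  scale-cong : ∀ {a b p q} → a ≈ b → p ≋ q → scale a p ≋ scale b q
  scale-cong {a} {b} {p} {q} e f = mk≋ λ i →
    trans (coeff-scale a p i) (trans (*-cong e (coeff-≈ f i)) (sym (coeff-scale b q i)))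

  ⊕-assoc : ∀ p q r → ((p ⊕ q) ⊕ r) ≋ (p ⊕ (q ⊕ r))
  ⊕-assoc p q r = mk≋ λ i → trans (coeff-⊕ (p ⊕ q) r i) (trans (+-congʳ (coeff-⊕ p q i))
    (trans (+-assoc _ _ _) (trans (+-congˡ (sym (coeff-⊕ q r i))) (sym (coeff-⊕ p (q ⊕ r) i)))))

  ⊕-comm : ∀ p q → (p ⊕ q) ≋ (q ⊕ p)
  ⊕-comm p q = mk≋ λ i → trans (coeff-⊕ p q i) (trans (+-comm _ _) (sym (coeff-⊕ q p i)))

  ⊕-identityʳ : ∀ p → (p ⊕ []) ≋ p
  ⊕-identityʳ p = mk≋ λ i → trans (coeff-⊕ p [] i) (+-identityʳ _)

  ⊕-inverseˡ : ∀ p → (neg p ⊕ p) ≋ []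
  ⊕-inverseˡ p = mk≋ λ i →
    trans (coeff-⊕ (neg p) p i) (trans (+-congʳ (coeff-neg p i)) (-‿inverseˡ _))

  ⊕-inverseʳ : ∀ p → (p ⊕ neg p) ≋ []
  ⊕-inverseʳ p = mk≋ λ i →
    trans (coeff-⊕ p (neg p) i) (trans (+-congˡ (coeff-neg p i)) (-‿inverseʳ _))

  ⊕-abelianGroup : AbelianGroup c ℓ
  ⊕-abelianGroup = record
    { Carrier = Poly₁ ; _≈_ = _≋_ ; _∙_ = _⊕_ ; ε = [] ; _⁻¹ = neg
    ; isAbelianGroup = record
      { isGroup = record
        { isMonoid = record
          { isSemigroup = record
            { isMagma = record
              { isEquivalence = record { refl = ≋-refl ; sym = ≋-sym ; trans = ≋-trans }
              ; ∙-cong = ⊕-cong }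
            ; assoc = ⊕-assoc }
          ; identity = (λ _ → ≋-refl) , ⊕-identityʳ }
        ; inverse = ⊕-inverseˡ , ⊕-inverseʳ
        ; ⁻¹-cong = neg-cong }
      ; comm = ⊕-comm } }

  open CommutativeSemigroupProperties (AbelianGroup.commutativeSemigroup ⊕-abelianGroup)
    using (interchange; x∙yz≈y∙xz)

  scale-zero : ∀ {a} → a ≈ 0# → ∀ q → scale a q ≋ []
  scale-zero {a} e q = mk≋ λ i → trans (coeff-scale a q i) (trans (*-congʳ e) (zeroˡ _))

  scale-one : ∀ q → scale 1# q ≋ q
  scale-one q = mk≋ λ i → trans (coeff-scale 1# q i) (*-identityˡ _)

  scale-⊕ : ∀ a p q → scale a (p ⊕ q) ≋ (scale a p ⊕ scale a q)
  scale-⊕ a p q = mk≋ λ i → trans (coeff-scale a (p ⊕ q) i) (trans (*-congˡ (coeff-⊕ p q i))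
    (trans (distribˡ _ _ _) (sym (trans (coeff-⊕ (scale a p) (scale a q) i)
      (+-cong (coeff-scale a p i) (coeff-scale a q i))))))

  scale-+ : ∀ a b q → scale (a + b) q ≋ (scale a q ⊕ scale b q)
  scale-+ a b q = mk≋ λ i → trans (coeff-scale (a + b) q i) (trans (distribʳ _ _ _)
    (sym (trans (coeff-⊕ (scale a q) (scale b q) i)
      (+-cong (coeff-scale a q i) (coeff-scale b q i)))))

  scale-scale : ∀ a b q → scale a (scale b q) ≋ scale (a * b) q
  scale-scale a b q = mk≋ λ i → trans (coeff-scale a (scale b q) i)
    (trans (*-congˡ (coeff-scale b q i)) (trans (sym (*-assoc _ _ _)) (sym (coeff-scale (a * b) q i))))

  ⊗-zeroˡ : ∀ p q → p ≋ [] → (p ⊗ q) ≋ []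
  ⊗-zeroˡ []      q e = ≋-refl
  ⊗-zeroˡ (a ∷ p) q e = ≋-trans
    (⊕-cong (scale-zero (coeff-≈ e zero) q) (∷-cong refl (⊗-zeroˡ p q (mk≋ λ i → coeff-≈ e (suc i)))))
    0∷[]≋[]

  ⊗-zeroʳ : ∀ q → (q ⊗ []) ≋ []
  ⊗-zeroʳ []      = ≋-refl
  ⊗-zeroʳ (a ∷ q) = ≋-trans (∷-cong refl (⊗-zeroʳ q)) 0∷[]≋[]

  ⊗-congˡ : ∀ {p p′} q → p ≋ p′ → (p ⊗ q) ≋ (p′ ⊗ q)
  ⊗-congˡ {[]}    {[]}     q e = ≋-refl
  ⊗-congˡ {[]}    {b ∷ p′} q e = ≋-sym (⊗-zeroˡ (b ∷ p′) q (≋-sym e))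
  ⊗-congˡ {a ∷ p} {[]}     q e = ⊗-zeroˡ (a ∷ p) q e
  ⊗-congˡ {a ∷ p} {b ∷ p′} q e =
    ⊕-cong (scale-cong (coeff-≈ e zero) ≋-refl) (∷-cong refl (⊗-congˡ {p} {p′} q (mk≋ λ i → coeff-≈ e (suc i))))

  ⊗-congʳ : ∀ p {q q′} → q ≋ q′ → (p ⊗ q) ≋ (p ⊗ q′)
  ⊗-congʳ []      e = ≋-refl
  ⊗-congʳ (a ∷ p) e = ⊕-cong (scale-cong refl e) (∷-cong refl (⊗-congʳ p e))

  ⊗-cong : ∀ {p p′ q q′} → p ≋ p′ → q ≋ q′ → (p ⊗ q) ≋ (p′ ⊗ q′)
  ⊗-cong {p′ = p′} {q} e f = ≋-trans (⊗-congˡ q e) (⊗-congʳ p′ f)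

  ⊗-distribʳ : ∀ q p p′ → ((p ⊕ p′) ⊗ q) ≋ ((p ⊗ q) ⊕ (p′ ⊗ q))
  ⊗-distribʳ q []      p′       = ≋-refl
  ⊗-distribʳ q (a ∷ p) []       = ≋-sym (⊕-identityʳ _)
  ⊗-distribʳ q (a ∷ p) (b ∷ p′) = ≋-trans
    (⊕-cong (scale-+ a b q) (∷-cong (sym (+-identityˡ 0#)) (⊗-distribʳ q p p′)))
    (interchange (scale a q) (scale b q) (0# ∷ (p ⊗ q)) (0# ∷ (p′ ⊗ q)))

  ⊗-∷ʳ : ∀ p b q → (p ⊗ (b ∷ q)) ≋ (scale b p ⊕ (0# ∷ (p ⊗ q)))
  ⊗-∷ʳ []      b q = ≋-sym 0∷[]≋[]
  ⊗-∷ʳ (a ∷ p) b q = ∷-cong (+-congʳ (*-comm a b))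
    (≋-trans (⊕-cong ≋-refl (⊗-∷ʳ p b q)) (x∙yz≈y∙xz (scale a q) (scale b p) (0# ∷ (p ⊗ q))))

  ⊗-comm : ∀ p q → (p ⊗ q) ≋ (q ⊗ p)
  ⊗-comm []      q = ≋-sym (⊗-zeroʳ q)
  ⊗-comm (a ∷ p) q = ≋-trans (⊕-cong ≋-refl (∷-cong refl (⊗-comm p q))) (≋-sym (⊗-∷ʳ q a p))

  scale-⊗ : ∀ a q r → (scale a q ⊗ r) ≋ scale a (q ⊗ r)
  scale-⊗ a []      r = ≋-refl
  scale-⊗ a (b ∷ q) r = ≋-trans
    (⊕-cong (≋-sym (scale-scale a b r)) (∷-cong (sym (zeroʳ a)) (scale-⊗ a q r)))
    (≋-sym (scale-⊕ a (scale b r) (0# ∷ (q ⊗ r))))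

  ⊗-assoc : ∀ p q r → ((p ⊗ q) ⊗ r) ≋ (p ⊗ (q ⊗ r))
  ⊗-assoc []      q r = ≋-refl
  ⊗-assoc (a ∷ p) q r = ≋-trans (⊗-distribʳ r (scale a q) (0# ∷ (p ⊗ q)))
    (⊕-cong (scale-⊗ a q r) (⊕-cong (scale-zero refl r) (∷-cong refl (⊗-assoc p q r))))

  ⊗-identityˡ : ∀ q → (one ⊗ q) ≋ q
  ⊗-identityˡ q = ≋-trans (⊕-cong (scale-one q) 0∷[]≋[]) (⊕-identityʳ q)

  ⊗-distribˡ : ∀ q p p′ → (q ⊗ (p ⊕ p′)) ≋ ((q ⊗ p) ⊕ (q ⊗ p′))
  ⊗-distribˡ q p p′ = ≋-trans (⊗-comm q (p ⊕ p′))
    (≋-trans (⊗-distribʳ q p p′) (⊕-cong (⊗-comm p q) (⊗-comm p′ q)))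

  polynomialRing : CommutativeRing c ℓ
  polynomialRing = record
    { Carrier = Poly₁ ; _≈_ = _≋_ ; _+_ = _⊕_ ; _*_ = _⊗_ ; -_ = neg ; 0# = [] ; 1# = one
    ; isCommutativeRing = record
      { isRing = record
        { +-isAbelianGroup = AbelianGroup.isAbelianGroup ⊕-abelianGroup
        ; *-cong = ⊗-cong
        ; *-assoc = ⊗-assoc
        ; *-identity = ⊗-identityˡ , (λ q → ≋-trans (⊗-comm q one) (⊗-identityˡ q))
        ; distrib = ⊗-distribˡ , ⊗-distribʳ }
      ; *-comm = ⊗-comm } }

module Parity where
  open import Data.Nat.Base using (_+_; _*_; _<_; _%_; ⌊_/2⌋)
  open import Data.Nat.Properties using (m≤n⇒∃[o]m+o≡n)
  open import Data.Nat.Tactic.RingSolver using (solve-∀)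
  open import Data.Product using (∃; _×_)
  open import Data.Sum using (_⊎_; inj₁; inj₂)
  open import Relation.Binary.PropositionalEquality using (_≡_; refl; trans; cong; sym)

  even⊎odd : ∀ n → (∃ λ k → n ≡ k * 2) ⊎ (∃ λ k → n ≡ suc (k * 2))
  even⊎odd zero = inj₁ (0 , refl)
  even⊎odd (suc n) with even⊎odd n
  ... | inj₁ (k , refl) = inj₂ (k , refl)
  ... | inj₂ (k , refl) = inj₁ (suc k , refl)

  ⌊k*2/2⌋≡k : ∀ k → ⌊ k * 2 /2⌋ ≡ k
  ⌊k*2/2⌋≡k zero    = refl
  ⌊k*2/2⌋≡k (suc k) = cong suc (⌊k*2/2⌋≡k k)

  ⌊1+k*2/2⌋≡k : ∀ k → ⌊ suc (k * 2) /2⌋ ≡ k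
  ⌊1+k*2/2⌋≡k zero    = refl
  ⌊1+k*2/2⌋≡k (suc k) = cong suc (⌊1+k*2/2⌋≡k k)

  [k*2]%2≡0 : ∀ k → k * 2 % 2 ≡ 0
  [k*2]%2≡0 zero    = refl
  [k*2]%2≡0 (suc k) = [k*2]%2≡0 k

  [1+k*2]%2≡1 : ∀ k → suc (k * 2) % 2 ≡ 1
  [1+k*2]%2≡1 zero    = refl
  [1+k*2]%2≡1 (suc k) = [1+k*2]%2≡1 k

  odd⇒≡1+k*2 : ∀ {n} → n % 2 ≡ 1 → ∃ λ k → n ≡ suc (k * 2)
  odd⇒≡1+k*2 {n} n%2≡1 with even⊎odd n
  ... | inj₂ n-odd         = n-odd
  ... | inj₁ (k , refl) with () ← trans (sym ([k*2]%2≡0 k)) n%2≡1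

  k+k≡k*2 : ∀ k → k + k ≡ k * 2
  k+k≡k*2 = solve-∀

  -- t is half the gap b - a, rounded down: the gap is 2t + 1 when n is even and 2t + 2 when n is odd.
  symmetric-pair : ∀ {a b n} → a < b → suc (a + b) ≡ n → ∃ λ t →
    (b ≡ suc (t + a) + t × n ≡ suc (t + a) * 2) ⊎
    (b ≡ suc (t + a) + suc t × n ≡ suc (suc (t + a) * 2))
  symmetric-pair {a} a<b refl with m≤n⇒∃[o]m+o≡n a<b
  ... | o , refl with even⊎odd o
  ...   | inj₁ (t , refl) = t , inj₁ (even-gap a t , even-gap-sum a t)
    where
    even-gap : ∀ a t → suc a + t * 2 ≡ suc (t + a) + t
    even-gap = solve-∀
    even-gap-sum : ∀ a t → suc (a + (suc a + t * 2)) ≡ suc (t + a) * 2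
    even-gap-sum = solve-∀
  ...   | inj₂ (t , refl) = t , inj₂ (odd-gap a t , odd-gap-sum a t)
    where
    odd-gap : ∀ a t → suc a + suc (t * 2) ≡ suc (t + a) + suc t
    odd-gap = solve-∀
    odd-gap-sum : ∀ a t → suc (a + (suc a + suc (t * 2))) ≡ suc (suc (t + a) * 2)
    odd-gap-sum = solve-∀

module FiniteSums {c ℓ} (R : CommutativeRing c ℓ) where
  open CommutativeRing R
  open import Algebra.Properties.Semiring.Sum semiring
    using (sum-syntax; sum-cong-≋; ∑-comm; *-distribˡ-sum; sum-permute)
  open CommutativeSemigroupProperties *-commutativeSemigroup using (x∙yz≈y∙xz; x∙yz≈z∙xy)
  open import Relation.Binary.Reasoning.Setoid setoid
  open import Data.Fin.Base using (Fin; opposite)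
  open import Data.Fin.Permutation using (reverse)

  Palindromic : ∀ {n} → (Fin n → Carrier) → Set ℓ
  Palindromic G = ∀ i → G (opposite i) ≈ G i

  ∑-opposite : ∀ {n} (f : Fin n → Carrier) → ∑[ i < n ] f (opposite i) ≈ ∑[ i < n ] f i
  ∑-opposite f = sym (sum-permute f reverse)

  ∑∑-factor : ∀ {n m} (a : Fin n → Fin m → Carrier) (u : Fin n → Carrier) (v : Fin m → Carrier) →
    ∑[ i < n ] ∑[ j < m ] (a i j * (u i * v j)) ≈ ∑[ i < n ] (u i * ∑[ j < m ] (a i j * v j))
  ∑∑-factor {n} {m} a u v = sum-cong-≋ {n} λ i → begin
    ∑[ j < m ] (a i j * (u i * v j))  ≈⟨ sum-cong-≋ {m} (λ j → x∙yz≈y∙xz (a i j) (u i) (v j)) ⟩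
    ∑[ j < m ] (u i * (a i j * v j))  ≈⟨ *-distribˡ-sum (u i) (λ j → a i j * v j) ⟨
    u i * ∑[ j < m ] (a i j * v j)    ∎

  ∑*∑-swap : ∀ {n m} (a : Fin n → Fin m → Carrier) (u : Fin n → Carrier) (v : Fin m → Carrier) →
    ∑[ i < n ] (u i * ∑[ j < m ] (a i j * v j)) ≈ ∑[ j < m ] (v j * ∑[ i < n ] (u i * a i j))
  ∑*∑-swap {n} {m} a u v = begin
    ∑[ i < n ] (u i * ∑[ j < m ] (a i j * v j))
      ≈⟨ sum-cong-≋ {n} (λ i → *-distribˡ-sum (u i) (λ j → a i j * v j)) ⟩
    ∑[ i < n ] ∑[ j < m ] (u i * (a i j * v j))
      ≈⟨ ∑-comm (λ i j → u i * (a i j * v j)) ⟩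
    ∑[ j < m ] ∑[ i < n ] (u i * (a i j * v j))
      ≈⟨ sum-cong-≋ {m} (λ j → sum-cong-≋ {n} (λ i → x∙yz≈z∙xy (u i) (a i j) (v j))) ⟩
    ∑[ j < m ] ∑[ i < n ] (v j * (u i * a i j))
      ≈⟨ sum-cong-≋ {m} (λ j → *-distribˡ-sum (v j) (λ i → u i * a i j)) ⟨
    ∑[ j < m ] (v j * ∑[ i < n ] (u i * a i j)) ∎

module Recurrence {c ℓ} (R : CommutativeRing c ℓ) (x : CommutativeRing.Carrier R) where
  open CommutativeRing R hiding (zero)
  open import Algebra.Properties.Semiring.Sum semiring using (sum-syntax; sum-cong-≋; sum-init-last)
  open import Algebra.Solver.Ring.NaturalCoefficients.Default commutativeSemiring
    using (solve; _:+_; _:*_; _:=_)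
  open import Relation.Binary.Reasoning.Setoid setoid
  open import Data.Bool.Base using (if_then_else_)
  open import Data.Fin.Base using (toℕ)
  open import Data.Fin.Properties using (toℕ-inject₁; toℕ-fromℕ)
  open import Data.Nat.Base using (_%_; _≡ᵇ_; ⌊_/2⌋; pred) renaming (_+_ to _+ℕ_; _*_ to _*ℕ_)
  import Relation.Binary.PropositionalEquality as ≡
  open Parity using (k+k≡k*2; [1+k*2]%2≡1; ⌊1+k*2/2⌋≡k; [k*2]%2≡0; ⌊k*2/2⌋≡k)

  Q : ℕ → Carrier
  Q zero          = 1#
  Q (suc zero)    = x
  Q (suc (suc n)) = x * Q (suc n) + Q n

  Q₋₁ : ℕ → Carrier
  Q₋₁ zero    = 0#
  Q₋₁ (suc n) = Q n

  Q-suc : ∀ n → Q (suc n) ≈ x * Q n + Q₋₁ n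
  Q-suc zero    = sym (trans (+-identityʳ _) (*-identityʳ x))
  Q-suc (suc n) = refl

  Q-+ : ∀ m n → Q (m +ℕ n) ≈ Q m * Q n + Q₋₁ m * Q₋₁ n
  Q-+ zero          n = sym (trans (+-cong (*-identityˡ _) (zeroˡ _)) (+-identityʳ _))
  Q-+ (suc zero)    n = trans (Q-suc n) (+-congˡ (sym (*-identityˡ _)))
  Q-+ (suc (suc m)) n = begin
    x * Q (suc m +ℕ n) + Q (m +ℕ n)
      ≈⟨ +-cong (*-congˡ (Q-+ (suc m) n)) (Q-+ m n) ⟩
    x * (Q (suc m) * Q n + Q m * Q₋₁ n) + (Q m * Q n + Q₋₁ m * Q₋₁ n)
      ≈⟨ solve 6 (λ x a b c d e → x :* (a :* c :+ b :* d) :+ (b :* c :+ e :* d)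
                                := (x :* a :+ b) :* c :+ (x :* b :+ e) :* d)
                 refl x (Q (suc m)) (Q m) (Q n) (Q₋₁ n) (Q₋₁ m) ⟩
    (x * Q (suc m) + Q m) * Q n + (x * Q m + Q₋₁ m) * Q₋₁ n
      ≈⟨ +-congˡ (*-congʳ (Q-suc m)) ⟨
    Q (suc (suc m)) * Q n + Q (suc m) * Q₋₁ n ∎

  Q-even-double : ∀ k → Q (suc k *ℕ 2) ≈ Q (suc k) * Q (suc k) + Q k * Q k
  Q-even-double k = begin
    Q (suc k *ℕ 2)        ≡⟨ ≡.cong Q (k+k≡k*2 (suc k)) ⟨
    Q (suc k +ℕ suc k)    ≈⟨ Q-+ (suc k) (suc k) ⟩
    Q (suc k) * Q (suc k) + Q k * Q k ∎

  ∑Q : ℕ → Carrier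
  ∑Q n = ∑[ i < n ] Q (toℕ i)

  ∑Q-suc : ∀ n → ∑Q (suc n) ≈ ∑Q n + Q n
  ∑Q-suc n = trans (sum-init-last {n} (Q ∘ toℕ))
    (+-cong (sum-cong-≋ {n} (λ i → reflexive (≡.cong Q (toℕ-inject₁ i)))) (reflexive (≡.cong Q (toℕ-fromℕ n))))

  centralFactor : ℕ → Carrier
  centralFactor n = if (n % 2) ≡ᵇ 1 then Q ⌊ n /2⌋ else (Q ⌊ n /2⌋ + Q (pred ⌊ n /2⌋))

  centralFactor-odd : ∀ k → centralFactor (suc (k *ℕ 2)) ≈ Q k
  centralFactor-odd k rewrite [1+k*2]%2≡1 k | ⌊1+k*2/2⌋≡k k = refl

  centralFactor-even : ∀ k → centralFactor (suc k *ℕ 2) ≈ Q (suc k) + Q k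
  centralFactor-even k rewrite [k*2]%2≡0 (suc k) | ⌊k*2/2⌋≡k k = refl

module Characteristic2 {c ℓ} (R : CommutativeRing c ℓ) (char2 : Char2 R) where
  open CommutativeRing R hiding (zero)
  open import Algebra.Properties.Semiring.Divisibility semiring using (_∣_; _,_)
  open import Algebra.Properties.Semiring.Sum semiring
    using (sum-syntax; sum-cong-≋; ∑-distrib-+; *-distribˡ-sum)
  open import Algebra.Solver.Ring.NaturalCoefficients.Default commutativeSemiring
    using (solve; _:+_; _:*_; _:=_; con)
  open import Relation.Binary.Reasoning.Setoid setoid
  open import Data.Bool.Base using (if_then_else_)
  open import Data.Fin.Base using (Fin; toℕ; opposite)
  open import Data.Fin.Properties using (opposite-prop; opposite-involutive; toℕ<n)
  open import Data.Nat.Base using (_<_) renaming (_+_ to _+ℕ_; _*_ to _*ℕ_)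
  open import Data.Nat.Properties using (<-cmp; _<?_; m+[n∸m]≡n) renaming (+-identityʳ to +ℕ-identityʳ)
  open import Data.Product using (∃; proj₁; proj₂)
  open import Data.Sum using (inj₁; inj₂)
  open import Relation.Binary.Definitions using (tri<; tri≈; tri>)
  open import Relation.Binary.PropositionalEquality as ≡ using (_≡_)
  open import Relation.Nullary using (¬_; does)
  open import Relation.Nullary.Decidable using (dec-true; dec-false)
  open Parity using (symmetric-pair; k+k≡k*2)
  open FiniteSums R

  x+x≈0 : ∀ x → x + x ≈ 0#
  x+x≈0 x = begin
    x + x              ≈⟨ +-cong (*-identityˡ x) (*-identityˡ x) ⟨
    1# * x + 1# * x    ≈⟨ distribʳ x 1# 1# ⟨
    (1# + 1#) * x      ≈⟨ *-congʳ char2 ⟩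
    0# * x             ≈⟨ zeroˡ x ⟩
    0#                 ∎

  x+[y+y]≈x : ∀ x y → x + (y + y) ≈ x
  x+[y+y]≈x x y = trans (+-congˡ (x+x≈0 y)) (+-identityʳ x)

  x+y≈z⇒x≈z+y : ∀ {x y z} → x + y ≈ z → x ≈ z + y
  x+y≈z⇒x≈z+y {x} {y} {z} eq = begin
    x              ≈⟨ x+[y+y]≈x x y ⟨
    x + (y + y)    ≈⟨ +-assoc x y y ⟨
    x + y + y      ≈⟨ +-congʳ eq ⟩
    z + y          ∎

  -x≈x : ∀ x → - x ≈ x
  -x≈x x = begin
    - x                ≈⟨ x+[y+y]≈x (- x) x ⟨
    - x + (x + x)      ≈⟨ +-assoc (- x) x x ⟨
    - x + x + x        ≈⟨ +-congʳ (-‿inverseˡ x) ⟩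
    0# + x             ≈⟨ +-identityˡ x ⟩
    x                  ∎

  ∑-symmetrised≈0 : ∀ {n} (E G : Fin n → Carrier) → Palindromic G →
    ∑[ i < n ] ((E i + E (opposite i)) * G i) ≈ 0#
  ∑-symmetrised≈0 {n} E G G-pal = begin
    ∑[ i < n ] ((E i + E (opposite i)) * G i)
      ≈⟨ sum-cong-≋ (λ i → distribʳ (G i) (E i) (E (opposite i))) ⟩
    ∑[ i < n ] (E i * G i + E (opposite i) * G i)
      ≈⟨ ∑-distrib-+ (λ i → E i * G i) (λ i → E (opposite i) * G i) ⟩
    ∑[ i < n ] (E i * G i) + ∑[ i < n ] (E (opposite i) * G i)
      ≈⟨ +-congˡ (sum-cong-≋ (λ i → *-congˡ (G-pal i))) ⟨
    ∑[ i < n ] (E i * G i) + ∑[ i < n ] (E (opposite i) * G (opposite i))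
      ≈⟨ +-congˡ (∑-opposite (λ i → E i * G i)) ⟩
    ∑[ i < n ] (E i * G i) + ∑[ i < n ] (E i * G i)
      ≈⟨ x+x≈0 _ ⟩
    0# ∎

  upperHalf : ∀ {n} → (Fin n → Carrier) → Fin n → Carrier
  upperHalf f i = if does (toℕ (opposite i) <? toℕ i) then f i else 0#

  upperHalf-> : ∀ {n} (f : Fin n → Carrier) i → toℕ (opposite i) < toℕ i → upperHalf f i ≈ f i
  upperHalf-> f i lt rewrite dec-true (toℕ (opposite i) <? toℕ i) lt = refl

  upperHalf-≯ : ∀ {n} (f : Fin n → Carrier) i → ¬ toℕ (opposite i) < toℕ i → upperHalf f i ≈ 0#
  upperHalf-≯ f i ¬lt rewrite dec-false (toℕ (opposite i) <? toℕ i) ¬lt = refl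

  toℕ-opposite-opposite : ∀ {n} (i : Fin n) → toℕ (opposite (opposite i)) ≡ toℕ i
  toℕ-opposite-opposite i = ≡.cong toℕ (opposite-involutive i)

  upperHalf-opposite-< : ∀ {n} (f : Fin n → Carrier) i → toℕ i < toℕ (opposite i) →
    upperHalf f (opposite i) ≈ f (opposite i)
  upperHalf-opposite-< f i lt =
    upperHalf-> f (opposite i) (≡.subst (_< toℕ (opposite i)) (≡.sym (toℕ-opposite-opposite i)) lt)

  upperHalf-opposite-≮ : ∀ {n} (f : Fin n → Carrier) i → ¬ toℕ i < toℕ (opposite i) →
    upperHalf f (opposite i) ≈ 0#
  upperHalf-opposite-≮ f i ¬lt =
    upperHalf-≯ f (opposite i) (¬lt ∘ ≡.subst (_< toℕ (opposite i)) (toℕ-opposite-opposite i))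

  module _ {n} (d : Carrier) (f : Fin n → Carrier)
    (pair-∣ : ∀ i → toℕ i < toℕ (opposite i) → d ∣ f i + f (opposite i))
    (middle-∣ : ∀ i → toℕ i ≡ toℕ (opposite i) → d ∣ f i) where

    multiple+symmetrised : ∀ i → ∃ λ q → f i ≈ q * d + (upperHalf f i + upperHalf f (opposite i))
    multiple+symmetrised i with <-cmp (toℕ i) (toℕ (opposite i))
    ... | tri< lt _ ¬gt with q , qd≈ ← pair-∣ i lt = q , (begin
      f i                                        ≈⟨ x+y≈z⇒x≈z+y (sym qd≈) ⟩
      q * d + f (opposite i)                     ≈⟨ +-congˡ (+-identityˡ _) ⟨
      q * d + (0# + f (opposite i))              ≈⟨ +-congˡ (+-cong (upperHalf-≯ f i ¬gt) (upperHalf-opposite-< f i lt)) ⟨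
      q * d + (upperHalf f i + upperHalf f (opposite i)) ∎)
    ... | tri≈ ¬lt eq ¬gt with q , qd≈ ← middle-∣ i eq = q , (begin
      f i                                        ≈⟨ qd≈ ⟨
      q * d                                      ≈⟨ x+[y+y]≈x (q * d) 0# ⟨
      q * d + (0# + 0#)                          ≈⟨ +-congˡ (+-cong (upperHalf-≯ f i ¬gt) (upperHalf-opposite-≮ f i ¬lt)) ⟨
      q * d + (upperHalf f i + upperHalf f (opposite i)) ∎)
    ... | tri> ¬lt _ gt = 0# , (begin
      f i                                        ≈⟨ +-identityʳ (f i) ⟨
      f i + 0#                                   ≈⟨ +-identityˡ _ ⟨
      0# + (f i + 0#)                            ≈⟨ +-cong (zeroˡ d) (+-cong (upperHalf-> f i gt) (upperHalf-opposite-≮ f i ¬lt)) ⟨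
      0# * d + (upperHalf f i + upperHalf f (opposite i)) ∎)

    -- The symmetrised upper half contributes nothing against a palindromic G.
    ∑-palindromic-factor : ∃ λ e → ∀ G → Palindromic G → ∑[ i < n ] (f i * G i) ≈ d * ∑[ i < n ] (e i * G i)
    ∑-palindromic-factor = e , factor
      where
      e : Fin n → Carrier
      e i = proj₁ (multiple+symmetrised i)

      U : Fin n → Carrier
      U i = upperHalf f i + upperHalf f (opposite i)

      e*d*G≈d*[e*G] : ∀ a b → a * d * b ≈ d * (a * b)
      e*d*G≈d*[e*G] a b = solve 3 (λ a d b → a :* d :* b := d :* (a :* b)) refl a d b

      factor : ∀ G → Palindromic G → ∑[ i < n ] (f i * G i) ≈ d * ∑[ i < n ] (e i * G i)
      factor G G-pal = begin
        ∑[ i < n ] (f i * G i)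
          ≈⟨ sum-cong-≋ (λ i → trans (*-congʳ (proj₂ (multiple+symmetrised i))) (distribʳ (G i) _ _)) ⟩
        ∑[ i < n ] (e i * d * G i + U i * G i)
          ≈⟨ ∑-distrib-+ (λ i → e i * d * G i) (λ i → U i * G i) ⟩
        ∑[ i < n ] (e i * d * G i) + ∑[ i < n ] (U i * G i)
          ≈⟨ +-cong (sum-cong-≋ λ i → e*d*G≈d*[e*G] (e i) (G i)) (∑-symmetrised≈0 (upperHalf f) G G-pal) ⟩
        ∑[ i < n ] (d * (e i * G i)) + 0#
          ≈⟨ +-identityʳ _ ⟩
        ∑[ i < n ] (d * (e i * G i))
          ≈⟨ *-distribˡ-sum d (λ i → e i * G i) ⟨
        d * ∑[ i < n ] (e i * G i) ∎

  module Sequence (x : Carrier) where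
    open Recurrence R x public

    Q-suc+Q₋₁ : ∀ n → Q (suc n) + Q₋₁ n ≈ x * Q n
    Q-suc+Q₋₁ n = sym (x+y≈z⇒x≈z+y (sym (Q-suc n)))

    -- The addition formula Q-+ read backwards: in characteristic 2 it also subtracts indices.
    Q-∸ : ∀ t p → Q p ≈ Q (suc (t +ℕ p)) * Q₋₁ t + Q (t +ℕ p) * Q t
    Q-∸ zero    p = sym (trans (+-cong (zeroʳ _) (*-identityʳ _)) (+-identityˡ _))
    Q-∸ (suc t) p = begin
      Q p
        ≈⟨ Q-∸ t p ⟩
      A * Q₋₁ t + B * Q t
        ≈⟨ x+[y+y]≈x _ (x * A * Q t) ⟨
      A * Q₋₁ t + B * Q t + (x * A * Q t + x * A * Q t)
        ≈⟨ solve 5 (λ x a b q r → a :* r :+ b :* q :+ (x :* a :* q :+ x :* a :* q)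
                                := (x :* a :+ b) :* q :+ a :* (x :* q :+ r))
                   refl x A B (Q t) (Q₋₁ t) ⟩
      (x * A + B) * Q t + A * (x * Q t + Q₋₁ t)
        ≈⟨ +-congˡ (*-congˡ (Q-suc t)) ⟨
      Q (suc (suc (t +ℕ p))) * Q t + A * Q (suc t) ∎
      where
      A B : Carrier
      A = Q (suc (t +ℕ p))
      B = Q (t +ℕ p)

    Q-cassini : ∀ k → Q k * Q k + Q₋₁ k * Q₋₁ k ≈ 1# + x * Q k * Q₋₁ k
    Q-cassini k = begin
      Q k * Q k + Q₋₁ k * Q₋₁ k
        ≈⟨ x+[y+y]≈x _ (x * Q k * Q₋₁ k) ⟨
      Q k * Q k + Q₋₁ k * Q₋₁ k + (x * Q k * Q₋₁ k + x * Q k * Q₋₁ k)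
        ≈⟨ solve 3 (λ x q r → q :* q :+ r :* r :+ (x :* q :* r :+ x :* q :* r)
                            := (x :* q :+ r) :* r :+ q :* q :+ x :* q :* r)
                   refl x (Q k) (Q₋₁ k) ⟩
      (x * Q k + Q₋₁ k) * Q₋₁ k + Q k * Q k + x * Q k * Q₋₁ k
        ≈⟨ +-congʳ (+-congʳ (*-congʳ (Q-suc k))) ⟨
      Q (suc k) * Q₋₁ k + Q k * Q k + x * Q k * Q₋₁ k
        ≈⟨ +-congʳ (sym (≡.subst (λ s → Q 0 ≈ Q (suc s) * Q₋₁ k + Q s * Q k) (+ℕ-identityʳ k) (Q-∸ k 0))) ⟩
      1# + x * Q k * Q₋₁ k ∎

    Q-odd-double : ∀ k → Q (suc (k *ℕ 2)) ≈ x * (Q k * Q k)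
    Q-odd-double k = begin
      Q (suc (k *ℕ 2))                    ≡⟨ ≡.cong (Q ∘ suc) (k+k≡k*2 k) ⟨
      Q (suc k +ℕ k)                      ≈⟨ Q-+ (suc k) k ⟩
      Q (suc k) * Q k + Q k * Q₋₁ k       ≈⟨ +-congˡ (*-comm (Q k) (Q₋₁ k)) ⟩
      Q (suc k) * Q k + Q₋₁ k * Q k       ≈⟨ distribʳ (Q k) _ _ ⟨
      (Q (suc k) + Q₋₁ k) * Q k           ≈⟨ *-congʳ (Q-suc+Q₋₁ k) ⟩
      x * Q k * Q k                       ≈⟨ *-assoc x (Q k) (Q k) ⟩
      x * (Q k * Q k)                     ∎

    Q-pair-even : ∀ t a → Q a + Q (suc (t +ℕ a) +ℕ t) ≈ (Q (suc (t +ℕ a)) + Q (t +ℕ a)) * (Q t + Q₋₁ t)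
    Q-pair-even t a = begin
      Q a + Q (suc (t +ℕ a) +ℕ t)
        ≈⟨ +-cong (Q-∸ t a) (Q-+ (suc (t +ℕ a)) t) ⟩
      (A * Q₋₁ t + B * Q t) + (A * Q t + B * Q₋₁ t)
        ≈⟨ solve 4 (λ a b q r → (a :* r :+ b :* q) :+ (a :* q :+ b :* r) := (a :+ b) :* (q :+ r))
                   refl A B (Q t) (Q₋₁ t) ⟩
      (A + B) * (Q t + Q₋₁ t) ∎
      where
      A B : Carrier
      A = Q (suc (t +ℕ a))
      B = Q (t +ℕ a)

    Q-pair-odd : ∀ t a → Q a + Q (suc (t +ℕ a) +ℕ suc t) ≈ Q (suc (t +ℕ a)) * (x * Q t)
    Q-pair-odd t a = begin
      Q a + Q (suc (t +ℕ a) +ℕ suc t)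
        ≈⟨ +-cong (Q-∸ t a) (Q-+ (suc (t +ℕ a)) (suc t)) ⟩
      (A * Q₋₁ t + B * Q t) + (A * Q (suc t) + B * Q t)
        ≈⟨ solve 5 (λ a b q q′ r → (a :* r :+ b :* q) :+ (a :* q′ :+ b :* q)
                                 := a :* (q′ :+ r) :+ (b :* q :+ b :* q))
                   refl A B (Q t) (Q (suc t)) (Q₋₁ t) ⟩
      A * (Q (suc t) + Q₋₁ t) + (B * Q t + B * Q t)
        ≈⟨ x+[y+y]≈x _ (B * Q t) ⟩
      A * (Q (suc t) + Q₋₁ t)
        ≈⟨ *-congˡ (Q-suc+Q₋₁ t) ⟩
      A * (x * Q t) ∎
      where
      A B : Carrier
      A = Q (suc (t +ℕ a))
      B = Q (t +ℕ a)

    ∑Q-odd : ∀ k → ∑Q (suc (k *ℕ 2)) ≈ Q k * (Q k + Q₋₁ k)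
    ∑Q-odd zero    = trans (+-identityʳ 1#) (sym (trans (*-identityˡ _) (+-identityʳ 1#)))
    ∑Q-odd (suc k) = begin
      ∑Q (suc (suc (suc (k *ℕ 2))))
        ≈⟨ trans (∑Q-suc (suc (suc (k *ℕ 2)))) (+-congʳ (∑Q-suc (suc (k *ℕ 2)))) ⟩
      ∑Q (suc (k *ℕ 2)) + Q (suc (k *ℕ 2)) + Q (suc k *ℕ 2)
        ≈⟨ +-cong (+-cong (∑Q-odd k) (Q-odd-double k)) (Q-even-double k) ⟩
      Q k * (Q k + Q₋₁ k) + x * (Q k * Q k) + (Q (suc k) * Q (suc k) + Q k * Q k)
        ≈⟨ solve 4 (λ x q q′ r → q :* (q :+ r) :+ x :* (q :* q) :+ (q′ :* q′ :+ q :* q)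
                               := q′ :* q′ :+ (x :* q :+ r) :* q :+ (q :* q :+ q :* q))
                   refl x (Q k) (Q (suc k)) (Q₋₁ k) ⟩
      Q (suc k) * Q (suc k) + (x * Q k + Q₋₁ k) * Q k + (Q k * Q k + Q k * Q k)
        ≈⟨ x+[y+y]≈x _ (Q k * Q k) ⟩
      Q (suc k) * Q (suc k) + (x * Q k + Q₋₁ k) * Q k
        ≈⟨ +-congˡ (*-congʳ (Q-suc k)) ⟨
      Q (suc k) * Q (suc k) + Q (suc k) * Q k
        ≈⟨ distribˡ (Q (suc k)) _ _ ⟨
      Q (suc k) * (Q (suc k) + Q k) ∎

    Q*[Q+Q₋₁]² : ∀ k → Q k * ((Q k + Q₋₁ k) * (Q k + Q₋₁ k)) ≈ Q k + Q (suc (k *ℕ 2)) * Q₋₁ k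
    Q*[Q+Q₋₁]² k = begin
      Q k * ((Q k + Q₋₁ k) * (Q k + Q₋₁ k))
        ≈⟨ solve 2 (λ q r → q :* ((q :+ r) :* (q :+ r))
                          := q :* (q :* q :+ r :* r) :+ (q :* q :* r :+ q :* q :* r))
                   refl (Q k) (Q₋₁ k) ⟩
      Q k * (Q k * Q k + Q₋₁ k * Q₋₁ k) + (Q k * Q k * Q₋₁ k + Q k * Q k * Q₋₁ k)
        ≈⟨ x+[y+y]≈x _ _ ⟩
      Q k * (Q k * Q k + Q₋₁ k * Q₋₁ k)
        ≈⟨ *-congˡ (Q-cassini k) ⟩
      Q k * (1# + x * Q k * Q₋₁ k)
        ≈⟨ solve 3 (λ x q r → q :* (con 1 :+ x :* q :* r) := q :+ x :* (q :* q) :* r)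
                   refl x (Q k) (Q₋₁ k) ⟩
      Q k + x * (Q k * Q k) * Q₋₁ k
        ≈⟨ +-congˡ (*-congʳ (Q-odd-double k)) ⟨
      Q k + Q (suc (k *ℕ 2)) * Q₋₁ k ∎

    centralFactor-∣-Q+Q : ∀ {a b n} → a < b → suc (a +ℕ b) ≡ n → centralFactor n ∣ Q a + Q b
    centralFactor-∣-Q+Q {a} a<b a+b+1≡n with symmetric-pair a<b a+b+1≡n
    ... | t , inj₁ (≡.refl , ≡.refl) = Q t + Q₋₁ t , (begin
      (Q t + Q₋₁ t) * centralFactor (suc (t +ℕ a) *ℕ 2)  ≈⟨ *-congˡ (centralFactor-even (t +ℕ a)) ⟩
      (Q t + Q₋₁ t) * (Q (suc (t +ℕ a)) + Q (t +ℕ a))    ≈⟨ *-comm _ _ ⟩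
      (Q (suc (t +ℕ a)) + Q (t +ℕ a)) * (Q t + Q₋₁ t)    ≈⟨ Q-pair-even t a ⟨
      Q a + Q (suc (t +ℕ a) +ℕ t)                         ∎)
    ... | t , inj₂ (≡.refl , ≡.refl) = x * Q t , (begin
      x * Q t * centralFactor (suc (suc (t +ℕ a) *ℕ 2))  ≈⟨ *-congˡ (centralFactor-odd (suc (t +ℕ a))) ⟩
      x * Q t * Q (suc (t +ℕ a))                          ≈⟨ *-comm _ _ ⟩
      Q (suc (t +ℕ a)) * (x * Q t)                        ≈⟨ Q-pair-odd t a ⟨
      Q a + Q (suc (t +ℕ a) +ℕ suc t)                     ∎)

    centralFactor-∣-Q : ∀ {a n} → suc (a +ℕ a) ≡ n → centralFactor n ∣ Q a
    centralFactor-∣-Q {a} ≡.refl = 1# , trans (*-identityˡ _)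
      (trans (reflexive (≡.cong (centralFactor ∘ suc) (k+k≡k*2 a))) (centralFactor-odd a))

    ∑Q-palindromic-factor : ∀ n → ∃ λ e → ∀ G → Palindromic G →
      ∑[ i < n ] (Q (toℕ i) * G i) ≈ centralFactor n * ∑[ i < n ] (e i * G i)
    ∑Q-palindromic-factor n = ∑-palindromic-factor (centralFactor n) (Q ∘ toℕ)
      (λ i lt → centralFactor-∣-Q+Q lt (toℕ+toℕ-opposite i))
      (λ i eq → centralFactor-∣-Q {toℕ i} (≡.subst (λ j → suc (toℕ i +ℕ j) ≡ n) (≡.sym eq) (toℕ+toℕ-opposite i)))
      where
      toℕ+toℕ-opposite : ∀ (i : Fin n) → suc (toℕ i +ℕ toℕ (opposite i)) ≡ n
      toℕ+toℕ-opposite i = ≡.trans (≡.cong (suc ∘ (toℕ i +ℕ_)) (opposite-prop i)) (m+[n∸m]≡n (toℕ<n i))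

  module _ (x y : Carrier) where
    private
      module X = Sequence x
      module Y = Sequence y

    centralFactor*-∣-∑∑ : ∀ {n m} (a : Fin n → Fin m → Carrier) →
      (∀ j → Palindromic (λ i → a i j)) → (∀ i → Palindromic (a i)) →
      X.centralFactor n * Y.centralFactor m ∣ ∑[ i < n ] ∑[ j < m ] (a i j * (X.Q (toℕ i) * Y.Q (toℕ j)))
    centralFactor*-∣-∑∑ {n} {m} a a-pal₁ a-pal₂ = q , (begin
      q * (cX * cY)
        ≈⟨ solve 3 (λ q c d → q :* (c :* d) := c :* (d :* q)) refl q cX cY ⟩
      cX * (cY * q)
        ≈⟨ *-congˡ (factorY H H-pal) ⟨
      cX * ∑[ j < m ] (Y.Q (toℕ j) * H j)
        ≈⟨ *-congˡ (∑*∑-swap a eX (Y.Q ∘ toℕ)) ⟨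
      cX * ∑[ i < n ] (eX i * G i)
        ≈⟨ factorX G G-pal ⟨
      ∑[ i < n ] (X.Q (toℕ i) * G i)
        ≈⟨ ∑∑-factor a (X.Q ∘ toℕ) (Y.Q ∘ toℕ) ⟨
      ∑[ i < n ] ∑[ j < m ] (a i j * (X.Q (toℕ i) * Y.Q (toℕ j))) ∎)
      where
      cX cY : Carrier
      cX = X.centralFactor n
      cY = Y.centralFactor m

      eX : Fin n → Carrier
      eX = proj₁ (X.∑Q-palindromic-factor n)
      factorX : ∀ G → Palindromic G → ∑[ i < n ] (X.Q (toℕ i) * G i) ≈ cX * ∑[ i < n ] (eX i * G i)
      factorX = proj₂ (X.∑Q-palindromic-factor n)

      eY : Fin m → Carrier
      eY = proj₁ (Y.∑Q-palindromic-factor m)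
      factorY : ∀ H → Palindromic H → ∑[ j < m ] (Y.Q (toℕ j) * H j) ≈ cY * ∑[ j < m ] (eY j * H j)
      factorY = proj₂ (Y.∑Q-palindromic-factor m)

      G : Fin n → Carrier
      G i = ∑[ j < m ] (a i j * Y.Q (toℕ j))
      G-pal : Palindromic G
      G-pal i = sum-cong-≋ {m} λ j → *-congʳ (a-pal₁ j i)

      H : Fin m → Carrier
      H j = ∑[ i < n ] (eX i * a i j)
      H-pal : Palindromic H
      H-pal j = sum-cong-≋ {n} λ i → *-congˡ (a-pal₂ i j)

      q : Carrier
      q = ∑[ j < m ] (eY j * H j)

    ∑Q*∑Q-∣-centralFactor*-mod : ∀ k l → let n = suc (k *ℕ 2); m = suc (l *ℕ 2) in
      ∃ λ q → ∃ λ α → ∃ λ β →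
        X.centralFactor n * Y.centralFactor m + q * (X.∑Q n * Y.∑Q m) ≈ α * X.Q n + β * Y.Q m
    ∑Q*∑Q-∣-centralFactor*-mod k l =
      Vx * Vy , X.Q₋₁ k * (Y.Q l + Y.Q m * Y.Q₋₁ l) , X.Q k * Y.Q₋₁ l , (begin
      X.centralFactor n * Y.centralFactor m + Vx * Vy * (X.∑Q n * Y.∑Q m)
        ≈⟨ +-cong (*-cong (X.centralFactor-odd k) (Y.centralFactor-odd l))
                  (*-congˡ (*-cong (X.∑Q-odd k) (Y.∑Q-odd l))) ⟩
      X.Q k * Y.Q l + Vx * Vy * (X.Q k * Vx * (Y.Q l * Vy))
        ≈⟨ +-congˡ (solve 4 (λ v w p q → v :* w :* (p :* v :* (q :* w)) := p :* (v :* v) :* (q :* (w :* w)))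
                           refl Vx Vy (X.Q k) (Y.Q l)) ⟩
      X.Q k * Y.Q l + X.Q k * (Vx * Vx) * (Y.Q l * (Vy * Vy))
        ≈⟨ +-congˡ (*-cong (X.Q*[Q+Q₋₁]² k) (Y.Q*[Q+Q₋₁]² l)) ⟩
      X.Q k * Y.Q l + (X.Q k + X.Q n * X.Q₋₁ k) * (Y.Q l + Y.Q m * Y.Q₋₁ l)
        ≈⟨ solve 6 (λ p q r s N M → p :* q :+ (p :+ N :* r) :* (q :+ M :* s)
                                  := r :* (q :+ M :* s) :* N :+ p :* s :* M :+ (p :* q :+ p :* q))
                   refl (X.Q k) (Y.Q l) (X.Q₋₁ k) (Y.Q₋₁ l) (X.Q n) (Y.Q m) ⟩
      X.Q₋₁ k * (Y.Q l + Y.Q m * Y.Q₋₁ l) * X.Q n + X.Q k * Y.Q₋₁ l * Y.Q m + (X.Q k * Y.Q l + X.Q k * Y.Q l)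
        ≈⟨ x+[y+y]≈x _ _ ⟩
      X.Q₋₁ k * (Y.Q l + Y.Q m * Y.Q₋₁ l) * X.Q n + X.Q k * Y.Q₋₁ l * Y.Q m ∎)
      where
      n m : ℕ
      n = suc (k *ℕ 2)
      m = suc (l *ℕ 2)
      Vx Vy : Carrier
      Vx = X.Q k + X.Q₋₁ k
      Vy = Y.Q l + Y.Q₋₁ l

module Grid {c ℓ} (K : CommutativeRing c ℓ) (char2 : Char2 K) where
  open Poly K
  private module K = CommutativeRing K
  module K[X] = PolynomialRing K
  module K[X][Y] = PolynomialRing K[X].polynomialRing

  open CommutativeRing K[X][Y].polynomialRing hiding (zero)
  open import Algebra.Properties.Semiring.Divisibility semiring using (_∣_; _,_)
  open import Algebra.Properties.Semiring.Sum semiring using (sum; sum-syntax; sum-cong-≋; *-distribˡ-sum; *-distribʳ-sum)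
  open import Relation.Binary.Reasoning.Setoid setoid
  open import Data.Bool.Base using (true; false; if_then_else_)
  open import Data.Fin.Base using (Fin; toℕ; zero; suc)
  open import Data.List.Base using (tabulate; allFin)
  open import Data.List.Properties using (map-tabulate)
  open import Data.Nat.Base using (_%_; _≡ᵇ_; ⌊_/2⌋; pred) renaming (_*_ to _*ℕ_)
  open import Data.Product using (∃; proj₁; proj₂)
  open import Relation.Binary.PropositionalEquality as ≡ using (_≡_)

  char2ᵀ : Char2 K[X][Y].polynomialRing
  char2ᵀ = K[X][Y].≋-trans (K[X][Y].∷-cong (K[X].≋-trans (K[X].∷-cong char2 K[X].≋-refl) K[X].0∷[]≋[]) K[X][Y].≋-refl)
                           K[X][Y].0∷[]≋[]

  open Characteristic2 K[X][Y].polynomialRing char2ᵀ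

  ⊕₂≡+ : ∀ p q → p ⊕₂ q ≡ p + q
  ⊕₂≡+ []      q       = ≡.refl
  ⊕₂≡+ (a ∷ p) []      = ≡.refl
  ⊕₂≡+ (a ∷ p) (b ∷ q) = ≡.cong ((a ⊕ b) ∷_) (⊕₂≡+ p q)

  ⊗₂≡* : ∀ p q → p ⊗₂ q ≡ p * q
  ⊗₂≡* []      q = ≡.refl
  ⊗₂≡* (a ∷ p) q = ≡.trans (⊕₂≡+ (map (a ⊗_) q) ([] ∷ (p ⊗₂ q))) (≡.cong (λ r → map (a ⊗_) q + ([] ∷ r)) (⊗₂≡* p q))

  coeffY≡coeff : ∀ p j → coeffY p j ≡ Poly.coeff K[X].polynomialRing p j
  coeffY≡coeff []      j       = ≡.refl
  coeffY≡coeff (a ∷ p) zero    = ≡.refl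
  coeffY≡coeff (a ∷ p) (suc j) = coeffY≡coeff p j

  ≈⇒≈₂ : ∀ {p q} → p ≈ q → p ≈₂ q
  ≈⇒≈₂ {p} {q} p≈q i j rewrite coeffY≡coeff p j | coeffY≡coeff q j = K[X].coeff-≈ (K[X][Y].coeff-≈ p≈q j) i

  -- In characteristic 2, a - r d = a + r d.
  ∣R-intro : ∀ {d a n m} r A B → a + r * d ≈ A * inX (Q n) + B * inY (Q m) → d ∣R[ n , m ] a
  ∣R-intro {d} {a} {n} {m} r A B eq = r , A , B , ≈⇒≈₂ (begin
    a ⊕₂ neg₂ (r ⊗₂ d)                       ≡⟨ ≡.trans (⊕₂≡+ a _) (≡.cong (λ z → a + - z) (⊗₂≡* r d)) ⟩
    a + - (r * d)                            ≈⟨ +-congˡ (-x≈x (r * d)) ⟩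
    a + r * d                                ≈⟨ eq ⟩
    A * inX (Q n) + B * inY (Q m)            ≡⟨ ≡.sym (≡.trans (⊕₂≡+ (A ⊗₂ inX (Q n)) (B ⊗₂ inY (Q m))) (≡.cong₂ _+_ (⊗₂≡* A (inX (Q n))) (⊗₂≡* B (inY (Q m))))) ⟩
    (A ⊗₂ inX (Q n)) ⊕₂ (B ⊗₂ inY (Q m))     ∎)

  module Image (φ : Poly₁ → Carrier)
    (φ-⊕ : ∀ p q → φ (p ⊕ q) ≈ φ p + φ q) (φ-⊗ : ∀ p q → φ (p ⊗ q) ≈ φ p * φ q)
    (φ-1 : φ (K.1# ∷ []) ≈ 1#) where
    private module S = Sequence (φ X)

    Q-image : ∀ n → φ (Q n) ≈ S.Q n
    Q-image zero          = φ-1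
    Q-image (suc zero)    = refl
    Q-image (suc (suc n)) = trans (φ-⊕ (X ⊗ Q (suc n)) (Q n))
      (+-cong (trans (φ-⊗ X (Q (suc n))) (*-congˡ {φ X} (Q-image (suc n)))) (Q-image n))

    centralFactor-image : ∀ n → φ (centralFactor n) ≈ S.centralFactor n
    centralFactor-image n = by-parity ((n % 2) ≡ᵇ 1)
      where
      h : ℕ
      h = ⌊ n /2⌋
      by-parity : ∀ b → φ (if b then Q h else (Q h ⊕ Q (pred h))) ≈ (if b then S.Q h else (S.Q h + S.Q (pred h)))
      by-parity true  = Q-image h
      by-parity false = trans (φ-⊕ (Q h) (Q (pred h))) (+-cong (Q-image h) (Q-image (pred h)))

  inX-⊗ : ∀ p q → inX (p ⊗ q) ≈ inX p * inX q
  inX-⊗ p q = K[X][Y].∷-cong (K[X].≋-sym (K[X].⊕-identityʳ _)) K[X][Y].≋-refl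

  inY-⊕ : ∀ p q → inY (p ⊕ q) ≡ inY p + inY q
  inY-⊕ []      q       = ≡.refl
  inY-⊕ (a ∷ p) []      = ≡.refl
  inY-⊕ (a ∷ p) (b ∷ q) = ≡.cong (((a K.+ b) ∷ []) ∷_) (inY-⊕ p q)

  inY-scale : ∀ a q → inY (scale a q) ≈ Poly.scale K[X].polynomialRing (a ∷ []) (inY q)
  inY-scale a []      = refl
  inY-scale a (b ∷ q) = K[X][Y].∷-cong (K[X].∷-cong (K.sym (K.+-identityʳ _)) K[X].≋-refl) (inY-scale a q)

  inY-⊗ : ∀ p q → inY (p ⊗ q) ≈ inY p * inY q
  inY-⊗ []      q = refl
  inY-⊗ (a ∷ p) q = trans (reflexive (inY-⊕ (scale a q) (K.0# ∷ (p ⊗ q))))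
    (+-cong (inY-scale a q) (K[X][Y].∷-cong K[X].0∷[]≋[] (inY-⊗ p q)))

  module QX = Sequence (inX X)
  module QY = Sequence (inY X)
  module ImageX = Image inX (λ _ _ → refl) inX-⊗ refl
  module ImageY = Image inY (λ p q → reflexive (inY-⊕ p q)) inY-⊗ refl

  constant : K.Carrier → Poly₂
  constant a = inX (a ∷ [])

  constant-cong : ∀ {a b} → a K.≈ b → constant a ≈ constant b
  constant-cong a≈b = K[X][Y].∷-cong (K[X].∷-cong a≈b K[X].≋-refl) K[X][Y].≋-refl

  scale₂≈constant* : ∀ a p → scale₂ a p ≈ constant a * p
  scale₂≈constant* a p = trans (scale₂≈map p) (sym (trans (+-congˡ K[X][Y].0∷[]≋[]) (+-identityʳ _)))
    where
    scale₂≈map : ∀ p → scale₂ a p ≈ map ((a ∷ []) ⊗_) p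
    scale₂≈map []      = refl
    scale₂≈map (u ∷ p) = K[X][Y].∷-cong
      (K[X].≋-sym (K[X].≋-trans (K[X].⊕-cong K[X].≋-refl K[X].0∷[]≋[]) (K[X].⊕-identityʳ _))) (scale₂≈map p)

  sum₂-allFin : ∀ n (F : Fin n → Poly₂) → sum₂ (map F (allFin n)) ≡ ∑[ i < n ] F i
  sum₂-allFin n F = ≡.trans (≡.cong sum₂ (map-tabulate (λ i → i) F)) (sum₂-tabulate n F)
    where
    sum₂-tabulate : ∀ n (F : Fin n → Poly₂) → sum₂ (tabulate F) ≡ sum F
    sum₂-tabulate zero    F = ≡.refl
    sum₂-tabulate (suc n) F = ≡.trans (⊕₂≡+ (F zero) _) (≡.cong (F zero +_) (sum₂-tabulate n (F ∘ suc)))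

  toR≈∑∑ : ∀ {n m} (w : Config n m) →
    toR w ≈ ∑[ i < n ] ∑[ j < m ] (constant (w i j) * (QX.Q (toℕ i) * QY.Q (toℕ j)))
  toR≈∑∑ {n} {m} w = trans (reflexive (sum₂-allFin n _)) (sum-cong-≋ {n} λ i →
    trans (reflexive (sum₂-allFin m _)) (sum-cong-≋ {m} λ j → begin
      scale₂ (w i j) (inX (Q (toℕ i)) ⊗₂ inY (Q (toℕ j)))
        ≈⟨ scale₂≈constant* (w i j) (inX (Q (toℕ i)) ⊗₂ inY (Q (toℕ j))) ⟩
      constant (w i j) * (inX (Q (toℕ i)) ⊗₂ inY (Q (toℕ j)))
        ≡⟨ ≡.cong (constant (w i j) *_) (⊗₂≡* (inX (Q (toℕ i))) (inY (Q (toℕ j)))) ⟩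
      constant (w i j) * (inX (Q (toℕ i)) * inY (Q (toℕ j)))
        ≈⟨ *-congˡ {constant (w i j)} (*-cong (ImageX.Q-image (toℕ i)) (ImageY.Q-image (toℕ j))) ⟩
      constant (w i j) * (QX.Q (toℕ i) * QY.Q (toℕ j)) ∎))

  central≈ : ∀ n m → central n m ≈ QX.centralFactor n * QY.centralFactor m
  central≈ n m = trans (reflexive (⊗₂≡* (inX (centralFactor n)) (inY (centralFactor m))))
    (*-cong (ImageX.centralFactor-image n) (ImageY.centralFactor-image m))

  allOn≈ : ∀ n m → allOn n m ≈ QX.∑Q n * QY.∑Q m
  allOn≈ n m = begin
    allOn n m
      ≈⟨ toR≈∑∑ {n} {m} (λ _ _ → K.1#) ⟩
    ∑[ i < n ] ∑[ j < m ] (1# * (QX.Q (toℕ i) * QY.Q (toℕ j)))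
      ≈⟨ sum-cong-≋ {n} (λ i → trans (sum-cong-≋ {m} λ j → *-identityˡ (QX.Q (toℕ i) * QY.Q (toℕ j)))
                                      (sym (*-distribˡ-sum {m} (QX.Q (toℕ i)) (QY.Q ∘ toℕ)))) ⟩
    ∑[ i < n ] (QX.Q (toℕ i) * QY.∑Q m)
      ≈⟨ *-distribʳ-sum {n} (QY.∑Q m) (QX.Q ∘ toℕ) ⟨
    QX.∑Q n * QY.∑Q m ∎

  central-∣R-toR : ∀ {n m} (w : Config n m) → DoublySymmetric w → central n m ∣R[ n , m ] toR w
  central-∣R-toR {n} {m} w w-sym = from-divisibility (centralFactor*-∣-∑∑ (inX X) (inY X) (λ i j → constant (w i j))
    (λ j i → constant-cong (K.sym (proj₁ (w-sym i j))))
    (λ i j → constant-cong (K.sym (proj₁ (proj₂ (w-sym i j))))))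
    where
    ∑∑ : Carrier
    ∑∑ = ∑[ i < n ] ∑[ j < m ] (constant (w i j) * (QX.Q (toℕ i) * QY.Q (toℕ j)))
    from-divisibility : QX.centralFactor n * QY.centralFactor m ∣ ∑∑ → central n m ∣R[ n , m ] toR w
    from-divisibility (q , q*c≈∑∑) = ∣R-intro {central n m} {toR w} {n} {m} q [] [] (begin
      toR w + q * central n m    ≈⟨ +-cong (toR≈∑∑ w) (trans (*-congˡ {q} (central≈ n m)) q*c≈∑∑) ⟩
      ∑∑ + ∑∑                    ≈⟨ x+x≈0 ∑∑ ⟩
      0#                         ∎)

  allOn-∣R-central : ∀ {n m} → (∃ λ k → n ≡ suc (k *ℕ 2)) → (∃ λ l → m ≡ suc (l *ℕ 2)) →
    allOn n m ∣R[ n , m ] central n m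
  allOn-∣R-central {n} {m} (k , ≡.refl) (l , ≡.refl) =
    from-congruence (∑Q*∑Q-∣-centralFactor*-mod (inX X) (inY X) k l)
    where
    from-congruence : (∃ λ q → ∃ λ α → ∃ λ β →
        QX.centralFactor n * QY.centralFactor m + q * (QX.∑Q n * QY.∑Q m) ≈ α * QX.Q n + β * QY.Q m) →
      allOn n m ∣R[ n , m ] central n m
    from-congruence (q , α , β , eq) = ∣R-intro {allOn n m} {central n m} {n} {m} q α β (begin
      central n m + q * allOn n m
        ≈⟨ +-cong (central≈ n m) (*-congˡ {q} (allOn≈ n m)) ⟩
      QX.centralFactor n * QY.centralFactor m + q * (QX.∑Q n * QY.∑Q m)
        ≈⟨ eq ⟩
      α * QX.Q n + β * QY.Q m
        ≈⟨ +-cong (*-congˡ {α} (ImageX.Q-image n)) (*-congˡ {β} (ImageY.Q-image m)) ⟨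
      α * inX (Q n) + β * inY (Q m) ∎)

lemma6 : ∀ {c ℓ : Level} (K : CommutativeRing c ℓ) → IsField K → Char2 K →
    ∀ (n m : ℕ) → 1 ≤ n → 1 ≤ m →
    (∀ (y : Poly.Config K n m) → Poly.DoublySymmetric K y →
    Poly._∣R[_,_]_ K (Poly.central K n m) n m (Poly.toR K y))
    × (n % 2 ≡ 1 → m % 2 ≡ 1 →
    Poly._∣R[_,_]_ K (Poly.allOn K n m) n m (Poly.central K n m))
lemma6 K _ char2 n m _ _ =
  Grid.central-∣R-toR K char2 ,
  λ n-odd m-odd → Grid.allOn-∣R-central K char2 (Parity.odd⇒≡1+k*2 {n} n-odd) (Parity.odd⇒≡1+k*2 {m} m-odd)
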